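{- Let $G$ be a connected graph with vertex set $[n]=\{1,\ldots,n\}$ and diameter $d \geq 2$. Then $$\chi_\rho(G) = (d-1) + n - \alpha\bigl(G_*^{[d-1]}\bigr),$$ where $\alpha$ denotes the stability number.
   Context: For a graph $G=(V,E)$, a packing $k$-coloring of $G$ is a partition $V_1,\ldots,V_k$ of $V$ such that for every $i\in\{1,\ldots,k\}$, any two distinct vertices $u,v\in V_i$ are at distance at least $i+1$ in $G$; the packing chromatic number $\chi_\rho(G)$ is the smallest such $k$. For integer $k\ge 1$, $G^k$ is the graph on $V(G)$ in which distinct $u,v$ are adjacent iff $d_G(u,v)\le k$ (so $G^1=G$). For $F\subseteq[n]$, $G^F$ is the graph with vertex set $\{(v,k): v\in V(G),\ k\in F\}$ and edge set $$\bigcup_{k\in F}\{((u,k),(v,k)) : (u,v)\in E(G^k)\}\ \cup \bigcup_{j,k\in F,\ j<k}\{((v,j),(v,k)) : v\in V(G)\}.$$ $G_*^F$ is the graph with vertex set $V(G^F)\cup\{(*,k): k\in F\}$ (where $*$ is a new symbol not in $V(G)$) and edge set $E(G^F)\cup\bigcup_{k\in F}\{((*,k),(v,k)) : v\in V(G)\}$. For a positive integer $p$, $[p]=\{1,\ldots,p\}$, and $G^{[p]}$, $G_*^{[p]}$ denote $G^F$, $G_*^F$ with $F=[p]$. -}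

module Defs where

open import Data.Nat using (ℕ; zero; suc; _≤_; _<_)
open import Data.Fin using (Fin; toℕ)
open import Data.Maybe using (Maybe; just; nothing)
open import Data.Product using (Σ; ∃; ∃-syntax; _×_; _,_)
open import Relation.Nullary using (¬_)
open import Relation.Binary using (Decidable)
open import Relation.Binary.PropositionalEquality using (_≡_; _≢_)
open import Function.Definitions using (Injective)

record Graph (n : ℕ) : Set₁ where
  field
    Adj   : Fin n → Fin n → Set
    adj?  : Decidable Adj
    sym   : ∀ {u v} → Adj u v → Adj v u
    irrefl : ∀ {u} → ¬ Adj u u
open Graph public

data Walk {n : ℕ} (G : Graph n) : Fin n → Fin n → ℕ → Set where
  nil  : ∀ {u} → Walk G u u 0
  cons : ∀ {u v w k} → Adj G u v → Walk G v w k → Walk G u w (suc k)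

DistLe : ∀ {n} → Graph n → Fin n → Fin n → ℕ → Set
DistLe G u v k = ∃[ m ] (m ≤ k × Walk G u v m)

Connected : ∀ {n} → Graph n → Set
Connected G = ∀ u v → ∃[ k ] Walk G u v k

HasDiameter : ∀ {n} → Graph n → ℕ → Set
HasDiameter G d =
  (∀ u v → DistLe G u v d) ×
  (∃[ u ] ∃[ v ] (∀ m → Walk G u v m → d ≤ m))

-- A packing k-coloring: c : V → Fin k, where colour i : Fin k stands for
-- class V_{toℕ i + 1}; two distinct vertices of class V_j must be at
-- distance ≥ j + 1, i.e. there is no walk of length ≤ j between them.
IsPackingColoring : ∀ {n} → Graph n → (k : ℕ) → (Fin n → Fin k) → Set
IsPackingColoring G k c =
  ∀ u v → u ≢ v → c u ≡ c v → ¬ DistLe G u v (suc (toℕ (c u)))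

HasPackingColoring : ∀ {n} → Graph n → ℕ → Set
HasPackingColoring {n} G k = Σ (Fin n → Fin k) (IsPackingColoring G k)

PackingChromaticNumber : ∀ {n} → Graph n → ℕ → Set
PackingChromaticNumber G χ =
  HasPackingColoring G χ × (∀ k → HasPackingColoring G k → χ ≤ k)

HasStableSet : {V : Set} → (V → V → Set) → ℕ → Set
HasStableSet {V} R a =
  Σ (Fin a → V) λ f → Injective _≡_ _≡_ f × (∀ x y → ¬ R (f x) (f y))

StabilityNumber : {V : Set} → (V → V → Set) → ℕ → Set
StabilityNumber R α = HasStableSet R α × (∀ b → HasStableSet R b → b ≤ α)

-- The graph G_*^{[p]}.  Vertices: (just v , i) is (v , toℕ i + 1) and
-- (nothing , i) is (* , toℕ i + 1), for i : Fin p.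
StarVertex : ℕ → ℕ → Set
StarVertex n p = Maybe (Fin n) × Fin p

data AdjStar {n p : ℕ} (G : Graph n) : StarVertex n p → StarVertex n p → Set where
  -- edges of G^{k} in layer k = toℕ i + 1
  layer    : ∀ {u v i} → u ≢ v → DistLe G u v (suc (toℕ i)) →
             AdjStar G (just u , i) (just v , i)
  vertical : ∀ {v i j} → i ≢ j → AdjStar G (just v , i) (just v , j)
  starL    : ∀ {v i} → AdjStar G (nothing , i) (just v , i)
  starR    : ∀ {v i} → AdjStar G (just v , i) (nothing , i)

-- Write p = d - 1; the theorem says χ + α = p + n.
-- From a stable set S of G_*^{[p]}: if (v , i) ∈ S, give v the rank r ≤ i of layer i among the
-- layers containing some (w , i) ∈ S (two such vertices of equal color lie in the same layer i,
-- hence are at distance > i + 1 ≥ r + 1), and give every other vertex a color of its own. Each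
-- vertex and each layer carries at most one element of S (vertical and star edges), and
-- (∗ , i) ∈ S forces layer i to be free, so |S| ≤ #covered vertices + #free layers, whence
-- χ + α ≤ p + n.
-- From a packing coloring c: a class V_j with j > p = d - 1 is a singleton since all distances
-- are ≤ d. Send a vertex v with c(v) ≤ p to (v , c(v)), a layer i missed by c to (∗ , i), and
-- everything else injectively to its color; the points not sent to colors form a stable set,
-- so n + p ≤ α + χ.

module Submission where

open import Defs hiding (sym)
open import Data.Nat using (ℕ; zero; suc; _≤_; _<_; _+_; _∸_; z≤n; s≤s; _<?_) renaming (_≟_ to _≟ℕ_)
open import Data.Nat.Properties
  using (≤-trans; ≤-reflexive; ≤-antisym; m≤n⇒m≤1+n; ≮⇒≥; +-suc; +-comm; +-monoˡ-≤; +-monoʳ-≤;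
         m≤n+m∸n; m+n∸n≡m; module ≤-Reasoning)
open import Data.Nat.Tactic.RingSolver using (solve-∀)
open import Data.Fin using (Fin; toℕ; fromℕ<; punchOut; splitAt; join; _↑ˡ_; _↑ʳ_; _≟_)
  renaming (zero to fzero; suc to fsuc)
open import Data.Fin.Properties
  using (suc-injective; 0≢1+n; toℕ-injective; toℕ<n; toℕ-fromℕ<; toℕ-↑ˡ; ↑ˡ-injective; ↑ʳ-injective;
         splitAt-↑ˡ; splitAt-↑ʳ; join-splitAt; punchOut-injective; injective⇒≤; any?)
open import Data.Vec.Functional using (Vector; _∷_)
open import Data.Maybe using (just; nothing)
open import Data.Maybe.Properties using () renaming (≡-dec to ≡-decᴹ)
open import Data.Product using (Σ; ∃; _×_; _,_)
open import Data.Product.Properties using (≡-dec)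
open import Data.Sum using (_⊎_; inj₁; inj₂)
open import Data.Sum.Properties using (inj₂-injective)
open import Function using (_∘_; _∘′_)
open import Function.Definitions using (Injective)
open import Level using (Level; 0ℓ)
open import Relation.Nullary using (¬_; Dec; yes; no; contradiction)
open import Relation.Unary using (Pred; Decidable)
open import Relation.Unary.Properties using (∁?)
open import Relation.Binary.PropositionalEquality

module _ {ℓ : Level} where

  count : ∀ {N} {P : Pred (Fin N) ℓ} → Decidable P → ℕ
  count {zero}  P? = 0
  count {suc N} P? with P? fzero
  ... | yes _ = suc (count (P? ∘ fsuc))
  ... | no  _ = count (P? ∘ fsuc)

  rank : ∀ {N} {P : Pred (Fin N) ℓ} (P? : Decidable P) {i} → P i → Fin (count P?)
  rank {suc N} P? {fzero} Pi with P? fzero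
  ... | yes _  = fzero
  ... | no ¬P0 = contradiction Pi ¬P0
  rank {suc N} P? {fsuc i} Pi with P? fzero
  ... | yes _ = fsuc (rank (P? ∘ fsuc) Pi)
  ... | no  _ = rank (P? ∘ fsuc) Pi

  toℕ-rank≤ : ∀ {N} {P : Pred (Fin N) ℓ} (P? : Decidable P) {i} (Pi : P i) → toℕ (rank P? Pi) ≤ toℕ i
  toℕ-rank≤ {suc N} P? {fzero} Pi with P? fzero
  ... | yes _  = z≤n
  ... | no ¬P0 = contradiction Pi ¬P0
  toℕ-rank≤ {suc N} P? {fsuc i} Pi with P? fzero
  ... | yes _ = s≤s (toℕ-rank≤ (P? ∘ fsuc) Pi)
  ... | no  _ = m≤n⇒m≤1+n (toℕ-rank≤ (P? ∘ fsuc) Pi)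

  rank-injective : ∀ {N} {P : Pred (Fin N) ℓ} (P? : Decidable P) {i j} (Pi : P i) (Pj : P j) →
                   rank P? Pi ≡ rank P? Pj → i ≡ j
  rank-injective {suc N} P? {fzero} {fzero} Pi Pj eq = refl
  rank-injective {suc N} P? {fzero} {fsuc j} Pi Pj eq with P? fzero
  ... | yes _  = contradiction eq 0≢1+n
  ... | no ¬P0 = contradiction Pi ¬P0
  rank-injective {suc N} P? {fsuc i} {fzero} Pi Pj eq with P? fzero
  ... | yes _  = contradiction (sym eq) 0≢1+n
  ... | no ¬P0 = contradiction Pj ¬P0
  rank-injective {suc N} P? {fsuc i} {fsuc j} Pi Pj eq with P? fzero
  ... | yes _ = cong fsuc (rank-injective (P? ∘ fsuc) Pi Pj (suc-injective eq))
  ... | no  _ = cong fsuc (rank-injective (P? ∘ fsuc) Pi Pj eq)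

  count+count-∁ : ∀ {N} {P : Pred (Fin N) ℓ} (P? : Decidable P) → count P? + count (∁? P?) ≡ N
  count+count-∁ {zero}  P? = refl
  count+count-∁ {suc N} P? with P? fzero
  ... | yes _ = cong suc (count+count-∁ (P? ∘ fsuc))
  ... | no  _ = trans (+-suc _ _) (cong suc (count+count-∁ (P? ∘ fsuc)))

↑ˡ≢↑ʳ : ∀ {m n} (i : Fin m) (j : Fin n) → i ↑ˡ n ≢ m ↑ʳ j
↑ˡ≢↑ʳ {m} {n} i j eq with trans (sym (splitAt-↑ˡ m i n)) (trans (cong (splitAt m) eq) (splitAt-↑ʳ m n j))
... | ()

splitAt-injective : ∀ m {n} → Injective _≡_ _≡_ (splitAt m {n})
splitAt-injective m {n} {x} {y} same =
  trans (sym (join-splitAt m n x)) (trans (cong (join m n) same) (join-splitAt m n y))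

module _ {A : Set} where

  ∷-injective : ∀ {b} {a : A} {g : Vector A b} → (∀ y → a ≢ g y) → Injective _≡_ _≡_ g →
                Injective _≡_ _≡_ (a ∷ g)
  ∷-injective a∉g g-inj {fzero}  {fzero}  eq = refl
  ∷-injective a∉g g-inj {fzero}  {fsuc y} eq = contradiction eq (a∉g y)
  ∷-injective a∉g g-inj {fsuc x} {fzero}  eq = contradiction (sym eq) (a∉g x)
  ∷-injective a∉g g-inj {fsuc x} {fsuc y} eq = cong fsuc (g-inj eq)

  punchOutʳ : ∀ {k} (j : Fin (suc k)) (s : A ⊎ Fin (suc k)) → s ≢ inj₂ j → A ⊎ Fin k
  punchOutʳ j (inj₁ a) _   = inj₁ a
  punchOutʳ j (inj₂ i) i≢j = inj₂ (punchOut (λ j≡i → i≢j (cong inj₂ (sym j≡i))))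

  punchOutʳ-injective : ∀ {k} (j : Fin (suc k)) s t (s≢j : s ≢ inj₂ j) (t≢j : t ≢ inj₂ j) →
                        punchOutʳ j s s≢j ≡ punchOutʳ j t t≢j → s ≡ t
  punchOutʳ-injective j (inj₁ a) (inj₁ b) _ _ refl = refl
  punchOutʳ-injective j (inj₂ i) (inj₂ i′) s≢j t≢j eq = cong inj₂
    (punchOut-injective (λ j≡i → s≢j (cong inj₂ (sym j≡i))) (λ j≡i′ → t≢j (cong inj₂ (sym j≡i′)))
                        (inj₂-injective eq))

  punchOutʳ-inj₁ : ∀ {k} (j : Fin (suc k)) s (s≢j : s ≢ inj₂ j) {a} →
                   punchOutʳ j s s≢j ≡ inj₁ a → s ≡ inj₁ a
  punchOutʳ-inj₁ j (inj₁ _) _ refl = refl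

  LeftImage : ∀ {M k} → (Fin M → A ⊎ Fin k) → ℕ → Set
  LeftImage e b = Σ (Vector A b) λ g → Injective _≡_ _≡_ g × (∀ y → ∃ λ x → e x ≡ inj₁ (g y))

  injective⇒leftImage : ∀ {M k} (e : Fin M → A ⊎ Fin k) → Injective _≡_ _≡_ e →
                        ∃ λ b → LeftImage e b × M ≤ b + k
  injective⇒leftImage {zero} e _ = 0 , ((λ ()) , (λ { {()} }) , λ ()) , z≤n
  injective⇒leftImage {suc M} {k} e e-inj with e fzero in e0≡
  ... | inj₁ a with injective⇒leftImage (e ∘′ fsuc) (suc-injective ∘ e-inj)
  ...   | b , (g , g-inj , g⊆e) , M≤b+k = suc b , (a ∷ g , ∷-injective a∉g g-inj , a∷g⊆e) , s≤s M≤b+k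
    where
    a∉g : ∀ y → a ≢ g y
    a∉g y a≡gy with g⊆e y
    ... | x , ex≡gy = 0≢1+n (e-inj (trans e0≡ (trans (cong inj₁ a≡gy) (sym ex≡gy))))
    a∷g⊆e : ∀ y → ∃ λ x → e x ≡ inj₁ ((a ∷ g) y)
    a∷g⊆e fzero    = fzero , e0≡
    a∷g⊆e (fsuc y) with g⊆e y
    ... | x , ex≡gy = fsuc x , ex≡gy
  injective⇒leftImage {suc M} {suc k} e e-inj | inj₂ j
    with injective⇒leftImage (λ x → punchOutʳ j (e (fsuc x)) (≢j x))
           (λ {x} {y} eq → suc-injective (e-inj (punchOutʳ-injective j _ _ (≢j x) (≢j y) eq)))
    where
    ≢j : ∀ x → e (fsuc x) ≢ inj₂ j
    ≢j x ex≡j = 0≢1+n (e-inj (trans e0≡ (sym ex≡j)))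
  ... | b , (g , g-inj , g⊆e) , M≤b+k =
    b , (g , g-inj , g⊆e′) , subst (suc M ≤_) (sym (+-suc b k)) (s≤s M≤b+k)
    where
    g⊆e′ : ∀ y → ∃ λ x → e x ≡ inj₁ (g y)
    g⊆e′ y with g⊆e y
    ... | x , ex≡gy = fsuc x , punchOutʳ-inj₁ j (e (fsuc x)) _ ex≡gy

DistLe-mono : ∀ {n} {G : Graph n} {u v k k′} → k ≤ k′ → DistLe G u v k → DistLe G u v k′
DistLe-mono k≤k′ (m , m≤k , walk) = m , ≤-trans m≤k k≤k′ , walk

module FromStableSet {n p α : ℕ} (G : Graph n) (f : Fin α → StarVertex n p)
                     (f-injective : Injective _≡_ _≡_ f) (f-stable : ∀ x y → ¬ AdjStar G (f x) (f y)) where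

  _∈S : StarVertex n p → Set
  s ∈S = ∃ λ x → f x ≡ s

  _∈S? : Decidable _∈S
  s ∈S? = any? (λ x → ≡-dec (≡-decᴹ _≟_) _≟_ (f x) s)

  ∈S-nonadjacent : ∀ {s t} → s ∈S → t ∈S → ¬ AdjStar G s t
  ∈S-nonadjacent (x , refl) (y , refl) = f-stable x y

  Covered : Pred (Fin n) 0ℓ
  Covered v = ∃ λ i → (just v , i) ∈S

  Occupied : Pred (Fin p) 0ℓ
  Occupied i = ∃ λ v → (just v , i) ∈S

  covered? : Decidable Covered
  covered? v = any? (λ i → (just v , i) ∈S?)

  occupied? : Decidable Occupied
  occupied? i = any? (λ v → (just v , i) ∈S?)

  #covered #uncovered #occupied #unoccupied K : ℕ
  #covered   = count covered?
  #uncovered = count (∁? covered?)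
  #occupied   = count occupied?
  #unoccupied = count (∁? occupied?)
  K = #occupied + #uncovered

  colorOf : (v : Fin n) → Dec (Covered v) → Fin K
  colorOf v (yes (i , v∈S)) = rank occupied? (v , v∈S) ↑ˡ #uncovered
  colorOf v (no v∉S)        = #occupied ↑ʳ rank (∁? covered?) v∉S

  coloring : Fin n → Fin K
  coloring v = colorOf v (covered? v)

  colorOf-packing : ∀ u v (cu : Dec (Covered u)) (cv : Dec (Covered v)) →
                    u ≢ v → colorOf u cu ≡ colorOf v cv → ¬ DistLe G u v (suc (toℕ (colorOf u cu)))
  colorOf-packing u v (yes (i , u∈S)) (yes (j , v∈S)) u≢v same dist
    with rank-injective occupied? (u , u∈S) (v , v∈S) (↑ˡ-injective _ _ _ same)
  ... | refl = ∈S-nonadjacent u∈S v∈S (layer u≢v (DistLe-mono (s≤s rank≤i) dist))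
    where
    rank≤i : toℕ (colorOf u (yes (i , u∈S))) ≤ toℕ i
    rank≤i = ≤-trans (≤-reflexive (toℕ-↑ˡ _ _)) (toℕ-rank≤ occupied? (u , u∈S))
  colorOf-packing u v (yes _) (no _)  _ same _ = ↑ˡ≢↑ʳ _ _ same
  colorOf-packing u v (no _)  (yes _) _ same _ = ↑ˡ≢↑ʳ _ _ (sym same)
  colorOf-packing u v (no u∉S) (no v∉S) u≢v same _ =
    u≢v (rank-injective (∁? covered?) u∉S v∉S (↑ʳ-injective _ _ _ same))

  coloring-packing : IsPackingColoring G K coloring
  coloring-packing u v = colorOf-packing u v (covered? u) (covered? v)

  star-unoccupied : ∀ {i} → (nothing , i) ∈S → ¬ Occupied i
  star-unoccupied ∗∈S (v , v∈S) = ∈S-nonadjacent ∗∈S v∈S starL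

  charge : ∀ s → s ∈S → Fin (#covered + #unoccupied)
  charge (just v , i)  v∈S = rank covered? (i , v∈S) ↑ˡ #unoccupied
  charge (nothing , i) ∗∈S = #covered ↑ʳ rank (∁? occupied?) (star-unoccupied ∗∈S)

  charge-injective : ∀ s t (s∈S : s ∈S) (t∈S : t ∈S) → charge s s∈S ≡ charge t t∈S → s ≡ t
  charge-injective (just v , i) (just w , j) v∈S w∈S same
    with rank-injective covered? (i , v∈S) (j , w∈S) (↑ˡ-injective _ _ _ same) | i ≟ j
  ... | refl | yes refl = refl
  ... | refl | no i≢j   = contradiction (vertical i≢j) (∈S-nonadjacent v∈S w∈S)
  charge-injective (just _ , _)  (nothing , _) _ _ same = contradiction same (↑ˡ≢↑ʳ _ _)
  charge-injective (nothing , _) (just _ , _)  _ _ same = contradiction (sym same) (↑ˡ≢↑ʳ _ _)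
  charge-injective (nothing , i) (nothing , j) ∗∈S ∗∈S′ same =
    cong (nothing ,_) (rank-injective (∁? occupied?) _ _ (↑ʳ-injective _ _ _ same))

  α≤covered+unoccupied : α ≤ #covered + #unoccupied
  α≤covered+unoccupied = injective⇒≤ {f = λ x → charge (f x) (x , refl)}
    (λ same → f-injective (charge-injective _ _ _ _ same))

  α+K≤p+n : α + K ≤ p + n
  α+K≤p+n = begin
    α + K                                               ≤⟨ +-monoˡ-≤ K α≤covered+unoccupied ⟩
    (#covered + #unoccupied) + (#occupied + #uncovered) ≡⟨ regroup #covered #unoccupied #occupied #uncovered ⟩
    (#occupied + #unoccupied) + (#covered + #uncovered)
      ≡⟨ cong₂ _+_ (count+count-∁ occupied?) (count+count-∁ covered?) ⟩
    p + n                                               ∎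
    where
    open ≤-Reasoning
    regroup : ∀ a b c e → (a + b) + (c + e) ≡ (c + b) + (a + e)
    regroup = solve-∀

stableSet⇒packingColoring : ∀ {n} p {α} (G : Graph n) → HasStableSet (AdjStar {n} {p} G) α →
                            ∃ λ K → HasPackingColoring G K × α + K ≤ p + n
stableSet⇒packingColoring p G (f , f-injective , f-stable) =
  K , (coloring , coloring-packing) , α+K≤p+n
  where open FromStableSet G f f-injective f-stable

module FromPackingColoring {n p χ : ℕ} (G : Graph n) (diam≤1+p : ∀ u v → DistLe G u v (suc p))
                           (c : Fin n → Fin χ) (c-packing : IsPackingColoring G χ c) where

  large-class-singleton : ∀ {v w} → p ≤ toℕ (c v) → c v ≡ c w → v ≡ w
  large-class-singleton {v} {w} p≤cv same with v ≟ w
  ... | yes v≡w = v≡w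
  ... | no v≢w  = contradiction (DistLe-mono (s≤s p≤cv) (diam≤1+p v w)) (c-packing v w v≢w same)

  LayerUsed : Fin p → Set
  LayerUsed i = ∃ λ v → toℕ (c v) ≡ toℕ i

  Fits : StarVertex n p → Set
  Fits (just v , i)  = toℕ (c v) ≡ toℕ i
  Fits (nothing , i) = ¬ LayerUsed i

  fits-stable : ∀ s t → Fits s → Fits t → ¬ AdjStar G s t
  fits-stable (just u , i) (just v , .i) cu≡i cv≡i (layer u≢v dist) =
    c-packing u v u≢v (toℕ-injective (trans cu≡i (sym cv≡i)))
              (subst (DistLe G u v ∘ suc) (sym cu≡i) dist)
  fits-stable (just v , i) (just .v , j) cv≡i cv≡j (vertical i≢j) = i≢j (toℕ-injective (trans (sym cv≡i) cv≡j))
  fits-stable (nothing , i) (just v , .i) free cv≡i starL = free (v , cv≡i)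
  fits-stable (just v , i) (nothing , .i) cv≡i free starR = free (v , cv≡i)

  Target : Set
  Target = StarVertex n p ⊎ Fin χ

  encodeVertex : (v : Fin n) → Dec (toℕ (c v) < p) → Target
  encodeVertex v (yes cv<p) = inj₁ (just v , fromℕ< cv<p)
  encodeVertex v (no _)     = inj₂ (c v)

  encodeLayer : (i : Fin p) → Dec (LayerUsed i) → Target
  encodeLayer i (yes (v , _)) = inj₂ (c v)
  encodeLayer i (no _)        = inj₁ (nothing , i)

  encode : Fin n ⊎ Fin p → Target
  encode (inj₁ v) = encodeVertex v (toℕ (c v) <? p)
  encode (inj₂ i) = encodeLayer i (any? (λ v → toℕ (c v) ≟ℕ toℕ i))

  encodeVertex-injective : ∀ v w dv dw → encodeVertex v dv ≡ encodeVertex w dw → v ≡ w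
  encodeVertex-injective v w (yes _) (yes _) refl = refl
  encodeVertex-injective v w (no cv≮p) (no _) same = large-class-singleton (≮⇒≥ cv≮p) (inj₂-injective same)

  encodeVertex≢encodeLayer : ∀ v i dv di → encodeVertex v dv ≢ encodeLayer i di
  encodeVertex≢encodeLayer v i (no cv≮p) (yes (w , cw≡i)) same =
    cv≮p (subst (_< p) (sym (trans (cong toℕ (inj₂-injective same)) cw≡i)) (toℕ<n i))
  encodeVertex≢encodeLayer v i (yes _) (no _) ()

  encodeLayer-injective : ∀ i j di dj → encodeLayer i di ≡ encodeLayer j dj → i ≡ j
  encodeLayer-injective i j (yes (v , cv≡i)) (yes (w , cw≡j)) same =
    toℕ-injective (trans (sym cv≡i) (trans (cong toℕ (inj₂-injective same)) cw≡j))
  encodeLayer-injective i j (no _) (no _) refl = refl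

  encode-injective : Injective _≡_ _≡_ encode
  encode-injective {inj₁ v} {inj₁ w} same = cong inj₁ (encodeVertex-injective v w _ _ same)
  encode-injective {inj₁ v} {inj₂ j} same = contradiction same (encodeVertex≢encodeLayer v j _ _)
  encode-injective {inj₂ i} {inj₁ w} same = contradiction (sym same) (encodeVertex≢encodeLayer w i _ _)
  encode-injective {inj₂ i} {inj₂ j} same = cong inj₂ (encodeLayer-injective i j _ _ same)

  encode-fits : ∀ x {s} → encode x ≡ inj₁ s → Fits s
  encode-fits (inj₁ v) with toℕ (c v) <? p
  ... | yes cv<p = λ { refl → sym (toℕ-fromℕ< cv<p) }
  encode-fits (inj₂ i) with any? (λ v → toℕ (c v) ≟ℕ toℕ i)
  ... | no free = λ { refl → free }

  stableSet : ∃ λ b → HasStableSet (AdjStar {n} {p} G) b × n + p ≤ b + χ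
  stableSet with injective⇒leftImage (encode ∘ splitAt n) (splitAt-injective n ∘ encode-injective)
  ... | b , (g , g-injective , g⊆encode) , n+p≤b+χ = b , (g , g-injective , g-stable) , n+p≤b+χ
    where
    g-fits : ∀ y → Fits (g y)
    g-fits y with g⊆encode y
    ... | x , encoded = encode-fits (splitAt n x) encoded
    g-stable : ∀ y z → ¬ AdjStar G (g y) (g z)
    g-stable y z = fits-stable (g y) (g z) (g-fits y) (g-fits z)

packingColoring⇒stableSet : ∀ {n} p {χ} (G : Graph n) → (∀ u v → DistLe G u v (suc p)) →
                            HasPackingColoring G χ → ∃ λ b → HasStableSet (AdjStar {n} {p} G) b × n + p ≤ b + χ
packingColoring⇒stableSet p G diam≤1+p (c , c-packing) = stableSet
  where open FromPackingColoring {p = p} G diam≤1+p c c-packing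

theorem2 : (n : ℕ) (G : Graph n) (d : ℕ) → Connected G → HasDiameter G d → 2 ≤ d →
           (χ α : ℕ) → PackingChromaticNumber G χ →
           StabilityNumber (AdjStar {n} {d ∸ 1} G) α →
           χ ≡ (d ∸ 1) + n ∸ α
theorem2 n G d _ (diam≤d , _) _ χ α (χ-coloring , χ-minimal) (α-stable , α-maximal) = begin-equality
  χ                 ≡⟨ m+n∸n≡m χ α ⟨
  χ + α ∸ α         ≡⟨ cong (_∸ α) (≤-antisym χ+α≤p+n p+n≤χ+α) ⟩
  p + n ∸ α         ∎
  where
  open ≤-Reasoning
  p : ℕ
  p = d ∸ 1
  χ+α≤p+n : χ + α ≤ p + n
  χ+α≤p+n with stableSet⇒packingColoring p G α-stable
  ... | K , K-coloring , α+K≤p+n = begin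
    χ + α ≡⟨ +-comm χ α ⟩
    α + χ ≤⟨ +-monoʳ-≤ α (χ-minimal K K-coloring) ⟩
    α + K ≤⟨ α+K≤p+n ⟩
    p + n ∎
  p+n≤χ+α : p + n ≤ χ + α
  p+n≤χ+α with packingColoring⇒stableSet p G (λ u v → DistLe-mono (m≤n+m∸n d 1) (diam≤d u v)) χ-coloring
  ... | b , b-stable , n+p≤b+χ = begin
    p + n ≡⟨ +-comm p n ⟩
    n + p ≤⟨ n+p≤b+χ ⟩
    b + χ ≤⟨ +-monoˡ-≤ χ (α-maximal b b-stable) ⟩
    α + χ ≡⟨ +-comm α χ ⟩
    χ + α ∎
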